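{- Let $\mathcal{X}\subseteq\{0,1\}^n$ be nonempty and let $\mathcal{U}=\{c_1,\dots,c_K\}\subset\mathbb{R}^n_{\ge0}$ with $K=2^k$. Let $0\le \ell\le k$, let $S_1,\dots,S_{2^\ell}$ be a partition of $[K]$ into sets each of cardinality $2^{k-\ell}$ (as obtained by repeatedly aggregating pairs of scenarios $k-\ell$ times), and set $\overline{c}_j=\frac{1}{2^{k-\ell}}\sum_{s\in S_j}c_s$, $\overline{\mathcal{U}}(\ell)=\{\overline{c}_1,\dots,\overline{c}_{2^\ell}\}$. Then any optimal solution $\overline{x}$ of $\min_{x\in\mathcal{X}}\max_{j\in[2^\ell]}\overline{c}_j^t x$ satisfies $\max_{i\in[K]}c_i^t\overline{x}\le \frac{K}{2^\ell}\min_{x\in\mathcal{X}}\max_{i\in[K]}c_i^tx$, i.e., it is a $2^{k-\ell}=K/2^\ell$-approximation for the min-max problem with scenario set $\mathcal{U}$.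
   Context: The min-max problem with finite scenario set $\mathcal{U}$ is $\min_{x\in\mathcal{X}}\max_{c\in\mathcal{U}}c^tx$; an $\alpha$-approximation is a feasible solution whose objective value is at most $\alpha$ times the optimal value.
   Formalization: The scenarios $c_1,\dots,c_K$ have nonnegative rational entries instead of nonnegative real entries. -}

module Defs where

open import Data.Nat as ℕ using (ℕ; zero; suc; _^_; _∸_; NonZero)
open import Data.Nat.Properties using (m^n≢0)
open import Data.Fin using (Fin; _≟_)
import Data.Fin as Fin
open import Data.Bool using (Bool; true; false; if_then_else_)
open import Data.Integer using (+_)
open import Data.Rational using (ℚ; 0ℚ; 1ℚ; _+_; _*_; _⊔_; _/_)
open import Data.List using (List; length; filter; allFin)
open import Relation.Nullary.Decidable using (⌊_⌋)
open import Function using (_∘_)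

toℚ : Bool → ℚ
toℚ true  = 1ℚ
toℚ false = 0ℚ

sumF : (m : ℕ) → (Fin m → ℚ) → ℚ
sumF zero    f = 0ℚ
sumF (suc m) f = f Fin.zero + sumF m (f ∘ Fin.suc)

maxF : (m : ℕ) → .{{NonZero m}} → (Fin m → ℚ) → ℚ
maxF (suc zero)    f = f Fin.zero
maxF (suc (suc m)) f = f Fin.zero ⊔ maxF (suc m) (f ∘ Fin.suc)

dot : {n : ℕ} → (Fin n → ℚ) → (Fin n → Bool) → ℚ
dot {n} c x = sumF n (λ t → c t * toℚ (x t))

worst : {n : ℕ} (m : ℕ) → .{{NonZero m}} → (Fin m → Fin n → ℚ) → (Fin n → Bool) → ℚ
worst m c x = maxF m (λ i → dot (c i) x)

-- the block S_j = σ⁻¹(j) of the partition given by σ : [K] → [L]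
block : {K L : ℕ} → (Fin K → Fin L) → Fin L → List (Fin K)
block {K} σ j = filter (λ i → σ i ≟ j) (allFin K)

aggregate : {n : ℕ} (k ℓ : ℕ) → (Fin (2 ^ k) → Fin n → ℚ) → (Fin (2 ^ k) → Fin (2 ^ ℓ))
          → Fin (2 ^ ℓ) → Fin n → ℚ
aggregate k ℓ c σ j t =
  ((+ 1) / (2 ^ (k ∸ ℓ))) {{m^n≢0 2 (k ∸ ℓ)}}
    * sumF (2 ^ k) (λ s → if ⌊ σ s ≟ j ⌋ then c s t else 0ℚ)

{-# OPTIONS --safe #-}
module Submission where

-- Let B = 2^(k∸ℓ) = K/2^ℓ be the block size, and W, A the worst-case costs under the
-- original and the averaged scenarios. An averaged scenario is dominated by the worst
-- scenario of its block, so A ≤ W. With nonnegative costs each scenario is dominated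
-- by the sum over its block, which is B times the block average, so W ≤ B·A.
-- For x̄ minimising A:  W x̄ ≤ B·A x̄ ≤ B·A x ≤ B·W x.

open import Defs
open import Data.Nat as ℕ using (ℕ; suc; _^_; _∸_; _≤_; NonZero)
open import Data.Nat.Properties as ℕP using (m^n≢0)
open import Data.Fin using (Fin; _≟_)
import Data.Fin as Fin
open import Data.Bool using (Bool; true; false; if_then_else_)
open import Data.Integer as ℤ using (+_)
import Data.Integer.Properties as ℤP
open import Data.Rational using (ℚ; 0ℚ; 1ℚ; _+_; _*_; _/_; NonNegative)
import Data.Rational as ℚ
import Data.Rational.Properties as ℚP
open import Data.Rational.Unnormalised using (mkℚᵘ; *≡*)
import Data.Rational.Unnormalised.Properties as ℚᵘP
open import Data.List using (length; filter; tabulate)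
open import Data.Product using (∃)
open import Relation.Unary using (Pred; Decidable)
open import Relation.Nullary.Decidable using (⌊_⌋; yes; no; dec-true; isYes≗does)
open import Relation.Binary.PropositionalEquality
open import Algebra.Bundles using (module CommutativeMonoid)
open import Algebra.Properties.CommutativeSemigroup
  (CommutativeMonoid.commutativeSemigroup ℚP.+-0-commutativeMonoid) using (interchange)
open import Algebra.Properties.CommutativeSemigroup
  (CommutativeMonoid.commutativeSemigroup ℚP.*-1-commutativeMonoid)
  using (xy∙z≈xz∙y; xy∙z≈y∙xz; x∙yz≈y∙xz)
open import Function using (_∘_; id)

/-≡-cross : ∀ i j m n .{{_ : NonZero m}} .{{_ : NonZero n}} →
            i ℤ.* + n ≡ j ℤ.* + m → i / m ≡ j / n
/-≡-cross i j (suc m) (suc n) eq = ℚP.fromℚᵘ-cong {mkℚᵘ i m} {mkℚᵘ j n} (*≡* eq)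

/-+ : ∀ i j m n .{{_ : NonZero m}} .{{_ : NonZero n}} →
      i / m + j / n ≡ ((i ℤ.* + n ℤ.+ j ℤ.* + m) / (m ℕ.* n)) {{ℕP.m*n≢0 m n}}
/-+ i j (suc m) (suc n) = ℚP.toℚᵘ-injective (ℚᵘP.≃-trans
  (ℚP.toℚᵘ-homo-+ (i / suc m) (j / suc n))
  (ℚᵘP.≃-trans (ℚᵘP.+-cong (ℚP.toℚᵘ-fromℚᵘ (mkℚᵘ i m)) (ℚP.toℚᵘ-fromℚᵘ (mkℚᵘ j n)))
               (ℚᵘP.≃-sym (ℚP.toℚᵘ-fromℚᵘ _))))

/-* : ∀ i j m n .{{_ : NonZero m}} .{{_ : NonZero n}} →
      (i / m) * (j / n) ≡ ((i ℤ.* j) / (m ℕ.* n)) {{ℕP.m*n≢0 m n}}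
/-* i j (suc m) (suc n) = ℚP.toℚᵘ-injective (ℚᵘP.≃-trans
  (ℚP.toℚᵘ-homo-* (i / suc m) (j / suc n))
  (ℚᵘP.≃-trans (ℚᵘP.*-cong (ℚP.toℚᵘ-fromℚᵘ (mkℚᵘ i m)) (ℚP.toℚᵘ-fromℚᵘ (mkℚᵘ j n)))
               (ℚᵘP.≃-sym (ℚP.toℚᵘ-fromℚᵘ _))))

1+n/1≡suc[n]/1 : ∀ n → 1ℚ + + n / 1 ≡ + suc n / 1
1+n/1≡suc[n]/1 n = trans (/-+ (+ 1) (+ n) 1 1)
  (/-≡-cross (+ 1 ℤ.* + 1 ℤ.+ + n ℤ.* + 1) (+ suc n) 1 1 (begin
  (+ 1 ℤ.+ + n ℤ.* + 1) ℤ.* + 1  ≡⟨ ℤP.*-identityʳ _ ⟩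
  + 1 ℤ.+ + n ℤ.* + 1            ≡⟨ cong (ℤ._+_ (+ 1)) (ℤP.*-identityʳ (+ n)) ⟩
  + suc n                        ≡⟨ ℤP.*-identityʳ (+ suc n) ⟨
  + suc n ℤ.* + 1                ∎))
  where open ≡-Reasoning

1/n*n/1≡1 : ∀ n .{{_ : NonZero n}} → (+ 1 / n) * (+ n / 1) ≡ 1ℚ
1/n*n/1≡1 n = trans (/-* (+ 1) (+ n) n 1)
  (/-≡-cross (+ 1 ℤ.* + n) (+ 1) (n ℕ.* 1) 1 {{ℕP.m*n≢0 n 1}} (begin
  (+ 1 ℤ.* + n) ℤ.* + 1  ≡⟨ ℤP.*-identityʳ _ ⟩
  + 1 ℤ.* + n            ≡⟨ cong (λ m → + 1 ℤ.* + m) (ℕP.*-identityʳ n) ⟨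
  + 1 ℤ.* + (n ℕ.* 1)    ∎))
  where open ≡-Reasoning

m*n/n≡m/1 : ∀ m n .{{_ : NonZero n}} → + (m ℕ.* n) / n ≡ + m / 1
m*n/n≡m/1 m n = /-≡-cross (+ (m ℕ.* n)) (+ m) n 1 (trans (ℤP.*-identityʳ _) (ℤP.pos-* m n))

sumF-cong : ∀ m {f g : Fin m → ℚ} → (∀ i → f i ≡ g i) → sumF m f ≡ sumF m g
sumF-cong ℕ.zero    f≡g = refl
sumF-cong (suc m) f≡g = cong₂ _+_ (f≡g Fin.zero) (sumF-cong m (f≡g ∘ Fin.suc))

sumF-mono-≤ : ∀ m {f g : Fin m → ℚ} → (∀ i → f i ℚ.≤ g i) → sumF m f ℚ.≤ sumF m g
sumF-mono-≤ ℕ.zero    f≤g = ℚP.≤-refl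
sumF-mono-≤ (suc m) f≤g = ℚP.+-mono-≤ (f≤g Fin.zero) (sumF-mono-≤ m (f≤g ∘ Fin.suc))

sumF-zero : ∀ m → sumF m (λ _ → 0ℚ) ≡ 0ℚ
sumF-zero ℕ.zero  = refl
sumF-zero (suc m) = trans (ℚP.+-identityˡ _) (sumF-zero m)

sumF-nonNeg : ∀ m {f : Fin m → ℚ} → (∀ i → 0ℚ ℚ.≤ f i) → 0ℚ ℚ.≤ sumF m f
sumF-nonNeg m {f} 0≤f = subst (ℚ._≤ sumF m f) (sumF-zero m) (sumF-mono-≤ m 0≤f)

f≤sumF : ∀ m {f : Fin m → ℚ} → (∀ i → 0ℚ ℚ.≤ f i) → ∀ i → f i ℚ.≤ sumF m f
f≤sumF (suc m) {f} 0≤f Fin.zero = begin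
  f Fin.zero                         ≡⟨ ℚP.+-identityʳ _ ⟨
  f Fin.zero + 0ℚ                    ≤⟨ ℚP.+-monoʳ-≤ (f Fin.zero) (sumF-nonNeg m (0≤f ∘ Fin.suc)) ⟩
  f Fin.zero + sumF m (f ∘ Fin.suc)  ∎
  where open ℚP.≤-Reasoning
f≤sumF (suc m) {f} 0≤f (Fin.suc i) = begin
  f (Fin.suc i)                      ≤⟨ f≤sumF m (0≤f ∘ Fin.suc) i ⟩
  sumF m (f ∘ Fin.suc)               ≡⟨ ℚP.+-identityˡ _ ⟨
  0ℚ + sumF m (f ∘ Fin.suc)          ≤⟨ ℚP.+-monoˡ-≤ _ (0≤f Fin.zero) ⟩
  f Fin.zero + sumF m (f ∘ Fin.suc)  ∎
  where open ℚP.≤-Reasoning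

sumF-+ : ∀ m (f g : Fin m → ℚ) → sumF m (λ i → f i + g i) ≡ sumF m f + sumF m g
sumF-+ ℕ.zero  f g = sym (ℚP.+-identityˡ 0ℚ)
sumF-+ (suc m) f g =
  trans (cong (_+_ (f Fin.zero + g Fin.zero)) (sumF-+ m (f ∘ Fin.suc) (g ∘ Fin.suc)))
        (interchange (f Fin.zero) (g Fin.zero) (sumF m (f ∘ Fin.suc)) (sumF m (g ∘ Fin.suc)))

sumF-*ˡ : ∀ m a (f : Fin m → ℚ) → sumF m (λ i → a * f i) ≡ a * sumF m f
sumF-*ˡ ℕ.zero  a f = sym (ℚP.*-zeroʳ a)
sumF-*ˡ (suc m) a f = trans (cong (_+_ (a * f Fin.zero)) (sumF-*ˡ m a (f ∘ Fin.suc)))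
                            (sym (ℚP.*-distribˡ-+ a (f Fin.zero) (sumF m (f ∘ Fin.suc))))

sumF-*ʳ : ∀ m a (f : Fin m → ℚ) → sumF m (λ i → f i * a) ≡ sumF m f * a
sumF-*ʳ ℕ.zero  a f = sym (ℚP.*-zeroˡ a)
sumF-*ʳ (suc m) a f = trans (cong (_+_ (f Fin.zero * a)) (sumF-*ʳ m a (f ∘ Fin.suc)))
                            (sym (ℚP.*-distribʳ-+ a (f Fin.zero) (sumF m (f ∘ Fin.suc))))

sumF-comm : ∀ m n (h : Fin m → Fin n → ℚ) →
            sumF n (λ t → sumF m (λ s → h s t)) ≡ sumF m (λ s → sumF n (h s))
sumF-comm m ℕ.zero  h = sym (sumF-zero m)
sumF-comm m (suc n) h =
  trans (cong (_+_ (sumF m (λ s → h s Fin.zero))) (sumF-comm m n (λ s → h s ∘ Fin.suc)))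
        (sym (sumF-+ m (λ s → h s Fin.zero) (λ s → sumF n (h s ∘ Fin.suc))))

sumF-toℚ-filter : ∀ {a p} {A : Set a} {P : Pred A p} (P? : Decidable P) m (f : Fin m → A) →
                  sumF m (λ s → toℚ ⌊ P? (f s) ⌋) ≡ + length (filter P? (tabulate f)) / 1
sumF-toℚ-filter P? ℕ.zero  f = refl
sumF-toℚ-filter P? (suc m) f with P? (f Fin.zero)
... | yes _ = trans (cong (_+_ 1ℚ) (sumF-toℚ-filter P? m (f ∘ Fin.suc)))
                    (1+n/1≡suc[n]/1 (length (filter P? (tabulate (f ∘ Fin.suc)))))
... | no _  = trans (ℚP.+-identityˡ _) (sumF-toℚ-filter P? m (f ∘ Fin.suc))

f≤maxF : ∀ m .{{_ : NonZero m}} (f : Fin m → ℚ) i → f i ℚ.≤ maxF m f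
f≤maxF (suc ℕ.zero)    f Fin.zero    = ℚP.≤-refl
f≤maxF (suc (suc m)) f Fin.zero    = ℚP.p≤p⊔q (f Fin.zero) _
f≤maxF (suc (suc m)) f (Fin.suc i) =
  ℚP.≤-trans (f≤maxF (suc m) (f ∘ Fin.suc) i) (ℚP.p≤q⊔p (f Fin.zero) _)

maxF-lub : ∀ m .{{_ : NonZero m}} (f : Fin m → ℚ) {M} → (∀ i → f i ℚ.≤ M) → maxF m f ℚ.≤ M
maxF-lub (suc ℕ.zero)    f f≤M = f≤M Fin.zero
maxF-lub (suc (suc m)) f f≤M =
  ℚP.⊔-lub (f≤M Fin.zero) (maxF-lub (suc m) (f ∘ Fin.suc) (f≤M ∘ Fin.suc))

toℚ-nonNeg : ∀ b → NonNegative (toℚ b)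
toℚ-nonNeg true  = ℚP.normalize-nonNeg 1 1
toℚ-nonNeg false = ℚP.normalize-nonNeg 0 1

*toℚ-monoˡ-≤ : ∀ b {v w} → v ℚ.≤ w → v * toℚ b ℚ.≤ w * toℚ b
*toℚ-monoˡ-≤ b = ℚP.*-monoʳ-≤-nonNeg (toℚ b) {{toℚ-nonNeg b}}

*toℚ-nonNeg : ∀ b {v} → 0ℚ ℚ.≤ v → 0ℚ ℚ.≤ v * toℚ b
*toℚ-nonNeg b {v} 0≤v = subst (ℚ._≤ v * toℚ b) (ℚP.*-zeroˡ (toℚ b)) (*toℚ-monoˡ-≤ b 0≤v)

if-then-0≡*toℚ : ∀ b v → (if b then v else 0ℚ) ≡ v * toℚ b
if-then-0≡*toℚ true  v = sym (ℚP.*-identityʳ v)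
if-then-0≡*toℚ false v = sym (ℚP.*-zeroʳ v)

module _ {n : ℕ} where

  dot-cong : ∀ {c c′ : Fin n → ℚ} x → (∀ t → c t ≡ c′ t) → dot c x ≡ dot c′ x
  dot-cong x c≡c′ = sumF-cong n (λ t → cong (_* toℚ (x t)) (c≡c′ t))

  dot-mono-≤ : ∀ {c c′ : Fin n → ℚ} x → (∀ t → c t ℚ.≤ c′ t) → dot c x ℚ.≤ dot c′ x
  dot-mono-≤ x c≤c′ = sumF-mono-≤ n (λ t → *toℚ-monoˡ-≤ (x t) (c≤c′ t))

  dot-nonNeg : ∀ {c : Fin n → ℚ} x → (∀ t → 0ℚ ℚ.≤ c t) → 0ℚ ℚ.≤ dot c x
  dot-nonNeg x 0≤c = sumF-nonNeg n (λ t → *toℚ-nonNeg (x t) (0≤c t))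

  c≤dot : ∀ {c : Fin n → ℚ} {x} → (∀ t → 0ℚ ℚ.≤ c t) → ∀ t → x t ≡ true → c t ℚ.≤ dot c x
  c≤dot {c} {x} 0≤c t xₜ≡true =
    subst (ℚ._≤ dot c x) (trans (cong (λ b → c t * toℚ b) xₜ≡true) (ℚP.*-identityʳ (c t)))
          (f≤sumF n (λ t → *toℚ-nonNeg (x t) (0≤c t)) t)

  dot-*ˡ : ∀ a (c : Fin n → ℚ) x → dot (λ t → a * c t) x ≡ a * dot c x
  dot-*ˡ a c x = trans (sumF-cong n (λ t → ℚP.*-assoc a (c t) _)) (sumF-*ˡ n a _)

  dot-const : ∀ a x → dot {n} (λ _ → a) x ≡ a * sumF n (toℚ ∘ x)
  dot-const a x = sumF-*ˡ n a (toℚ ∘ x)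

  dot-transpose : ∀ {m} (c : Fin m → Fin n → ℚ) χ y →
                  dot (λ t → dot (λ s → c s t) χ) y ≡ dot (λ s → dot (c s) y) χ
  dot-transpose {m} c χ y = begin
    sumF n (λ t → sumF m (λ s → c s t * toℚ (χ s)) * toℚ (y t))
      ≡⟨ sumF-cong n (λ t → sumF-*ʳ m (toℚ (y t)) _) ⟨
    sumF n (λ t → sumF m (λ s → c s t * toℚ (χ s) * toℚ (y t)))
      ≡⟨ sumF-cong n (λ t → sumF-cong m (λ s → xy∙z≈xz∙y (c s t) _ _)) ⟩
    sumF n (λ t → sumF m (λ s → c s t * toℚ (y t) * toℚ (χ s)))
      ≡⟨ sumF-comm m n _ ⟩
    sumF m (λ s → sumF n (λ t → c s t * toℚ (y t) * toℚ (χ s)))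
      ≡⟨ sumF-cong m (λ s → sumF-*ʳ n (toℚ (χ s)) _) ⟩
    sumF m (λ s → sumF n (λ t → c s t * toℚ (y t)) * toℚ (χ s)) ∎
    where open ≡-Reasoning

inBlock : {K L : ℕ} → (Fin K → Fin L) → Fin L → Fin K → Bool
inBlock σ j s = ⌊ σ s ≟ j ⌋

inBlock-self : ∀ {K L} (σ : Fin K → Fin L) i → inBlock σ (σ i) i ≡ true
inBlock-self σ i = trans (isYes≗does (σ i ≟ σ i)) (dec-true (σ i ≟ σ i) refl)

blockAverage : {n K L : ℕ} (B : ℕ) .{{_ : NonZero B}} →
               (Fin K → Fin n → ℚ) → (Fin K → Fin L) → Fin L → Fin n → ℚ
blockAverage {K = K} B c σ j t = (+ 1 / B) * sumF K (λ s → if ⌊ σ s ≟ j ⌋ then c s t else 0ℚ)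

module _ {n K L : ℕ} (B : ℕ) .{{_ : NonZero B}} (c : Fin K → Fin n → ℚ) (σ : Fin K → Fin L) where

  dot-blockAverage : ∀ j y →
    dot (blockAverage B c σ j) y ≡ (+ 1 / B) * dot (λ s → dot (c s) y) (inBlock σ j)
  dot-blockAverage j y = begin
    dot (blockAverage B c σ j) y
      ≡⟨ dot-cong y (λ t → cong (+ 1 / B *_)
                                (sumF-cong K (λ s → if-then-0≡*toℚ (inBlock σ j s) (c s t)))) ⟩
    dot (λ t → (+ 1 / B) * dot (λ s → c s t) (inBlock σ j)) y
      ≡⟨ dot-*ˡ (+ 1 / B) _ y ⟩
    (+ 1 / B) * dot (λ t → dot (λ s → c s t) (inBlock σ j)) y
      ≡⟨ cong (+ 1 / B *_) (dot-transpose c (inBlock σ j) y) ⟩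
    (+ 1 / B) * dot (λ s → dot (c s) y) (inBlock σ j) ∎
    where open ≡-Reasoning

  worst-blockAverage≤worst : .{{_ : NonZero K}} .{{_ : NonZero L}} →
    (∀ j → length (block σ j) ≡ B) → ∀ y → worst L (blockAverage B c σ) y ℚ.≤ worst K c y
  worst-blockAverage≤worst |S|≡B y = maxF-lub L _ average≤
    where
    W : ℚ
    W = worst K c y
    average≤ : ∀ j → dot (blockAverage B c σ j) y ℚ.≤ W
    average≤ j = begin
      dot (blockAverage B c σ j) y
        ≡⟨ dot-blockAverage j y ⟩
      (+ 1 / B) * dot (λ s → dot (c s) y) (inBlock σ j)
        ≤⟨ ℚP.*-monoˡ-≤-nonNeg (+ 1 / B) {{ℚP.normalize-nonNeg 1 B}}
             (dot-mono-≤ (inBlock σ j) (f≤maxF K (λ s → dot (c s) y))) ⟩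
      (+ 1 / B) * dot (λ _ → W) (inBlock σ j)
        ≡⟨ cong (+ 1 / B *_) (dot-const W (inBlock σ j)) ⟩
      (+ 1 / B) * (W * sumF K (toℚ ∘ inBlock σ j))
        ≡⟨ cong (λ r → (+ 1 / B) * (W * r)) (trans (sumF-toℚ-filter (λ s → σ s ≟ j) K id)
                                                    (cong (λ m → + m / 1) (|S|≡B j))) ⟩
      (+ 1 / B) * (W * (+ B / 1))
        ≡⟨ x∙yz≈y∙xz (+ 1 / B) W (+ B / 1) ⟩
      W * ((+ 1 / B) * (+ B / 1))
        ≡⟨ cong (W *_) (1/n*n/1≡1 B) ⟩
      W * 1ℚ
        ≡⟨ ℚP.*-identityʳ W ⟩
      W ∎
      where open ℚP.≤-Reasoning

  worst≤B*worst-blockAverage : .{{_ : NonZero K}} .{{_ : NonZero L}} →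
    (∀ s t → 0ℚ ℚ.≤ c s t) → ∀ y → worst K c y ℚ.≤ (+ B / 1) * worst L (blockAverage B c σ) y
  worst≤B*worst-blockAverage 0≤c y = maxF-lub K _ scenario≤
    where
    scenario≤ : ∀ i → dot (c i) y ℚ.≤ (+ B / 1) * worst L (blockAverage B c σ) y
    scenario≤ i = begin
      dot (c i) y
        ≤⟨ c≤dot {x = inBlock σ (σ i)} (λ s → dot-nonNeg y (0≤c s)) i (inBlock-self σ i) ⟩
      S
        ≡⟨ ℚP.*-identityˡ S ⟨
      1ℚ * S
        ≡⟨ cong (_* S) (1/n*n/1≡1 B) ⟨
      (+ 1 / B) * (+ B / 1) * S
        ≡⟨ xy∙z≈y∙xz (+ 1 / B) (+ B / 1) S ⟩
      (+ B / 1) * ((+ 1 / B) * S)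
        ≡⟨ cong (+ B / 1 *_) (dot-blockAverage (σ i) y) ⟨
      (+ B / 1) * dot (blockAverage B c σ (σ i)) y
        ≤⟨ ℚP.*-monoˡ-≤-nonNeg (+ B / 1) {{ℚP.normalize-nonNeg B 1}}
             (f≤maxF L (λ j → dot (blockAverage B c σ j) y) (σ i)) ⟩
      (+ B / 1) * worst L (blockAverage B c σ) y ∎
      where
      S : ℚ
      S = dot (λ s → dot (c s) y) (inBlock σ (σ i))
      open ℚP.≤-Reasoning

  blockAverage-optimum-approx : .{{_ : NonZero K}} .{{_ : NonZero L}} →
    (∀ j → length (block σ j) ≡ B) → (∀ s t → 0ℚ ℚ.≤ c s t) → ∀ x̄ x →
    worst L (blockAverage B c σ) x̄ ℚ.≤ worst L (blockAverage B c σ) x →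
    worst K c x̄ ℚ.≤ (+ B / 1) * worst K c x
  blockAverage-optimum-approx |S|≡B 0≤c x̄ x x̄-better = begin
    worst K c x̄                                ≤⟨ worst≤B*worst-blockAverage 0≤c x̄ ⟩
    (+ B / 1) * worst L (blockAverage B c σ) x̄  ≤⟨ B*-mono x̄-better ⟩
    (+ B / 1) * worst L (blockAverage B c σ) x  ≤⟨ B*-mono (worst-blockAverage≤worst |S|≡B x) ⟩
    (+ B / 1) * worst K c x                    ∎
    where
    open ℚP.≤-Reasoning
    B*-mono : ∀ {p q} → p ℚ.≤ q → (+ B / 1) * p ℚ.≤ (+ B / 1) * q
    B*-mono = ℚP.*-monoˡ-≤-nonNeg (+ B / 1) {{ℚP.normalize-nonNeg B 1}}

corollary1 : (n k ℓ : ℕ)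
    → (X : (Fin n → Bool) → Set)
    → ∃ X
    → (c : Fin (2 ^ k) → Fin n → ℚ)
    → (∀ i t → 0ℚ ℚ.≤ c i t)
    → ℓ ≤ k
    → (σ : Fin (2 ^ k) → Fin (2 ^ ℓ))
    → (∀ j → length (block σ j) ≡ 2 ^ (k ∸ ℓ))
    → (xbar : Fin n → Bool)
    → X xbar
    → (∀ x → X x → worst (2 ^ ℓ) {{m^n≢0 2 ℓ}} (aggregate k ℓ c σ) xbar
                    ℚ.≤ worst (2 ^ ℓ) {{m^n≢0 2 ℓ}} (aggregate k ℓ c σ) x)
    → ∀ x → X x
    → worst (2 ^ k) {{m^n≢0 2 k}} c xbar
        ℚ.≤ ((+ (2 ^ k)) / (2 ^ ℓ)) {{m^n≢0 2 ℓ}} * worst (2 ^ k) {{m^n≢0 2 k}} c x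
-- aggregate k ℓ is blockAverage (2 ^ (k ∸ ℓ)) by definition.
corollary1 n k ℓ X _ c 0≤c ℓ≤k σ |S|≡B x̄ _ x̄-optimal x x∈X =
  subst (λ r → worst (2 ^ k) c x̄ ℚ.≤ r * worst (2 ^ k) c x) (sym K/2^ℓ≡B)
    (blockAverage-optimum-approx B c σ |S|≡B 0≤c x̄ x (x̄-optimal x x∈X))
  where
  B : ℕ
  B = 2 ^ (k ∸ ℓ)
  instance
    _ : NonZero B
    _ = m^n≢0 2 (k ∸ ℓ)
    _ : NonZero (2 ^ k)
    _ = m^n≢0 2 k
    _ : NonZero (2 ^ ℓ)
    _ = m^n≢0 2 ℓ
  K/2^ℓ≡B : + (2 ^ k) / 2 ^ ℓ ≡ + B / 1
  K/2^ℓ≡B = trans (ℚP./-cong (cong +_ 2^k≡B*2^ℓ) refl) (m*n/n≡m/1 B (2 ^ ℓ))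
    where
    2^k≡B*2^ℓ : 2 ^ k ≡ B ℕ.* 2 ^ ℓ
    2^k≡B*2^ℓ = trans (cong (2 ^_) (sym (ℕP.m∸n+n≡m ℓ≤k))) (ℕP.^-distribˡ-+-* 2 (k ∸ ℓ) ℓ)
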